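{- Let $G$ be a finite connected simple graph on vertex set $\{1,\dots,n\}$ with maximum degree $\Delta$. Suppose a terminating chip-firing game with $N$ chips was played on $G$, let $x_i$ be the number of times vertex $i$ fired and $s=\sum_{i=1}^n x_i$ the total number of firings. Let $k$ be a vertex with $x_k=0$. Then $$ s \leq n\Big(f(\Delta-1) + o(2N-\Delta+1)\Big),$$ where $f=\max_{1\le i\le n} L^{\dagger}_{ii}$ and $o=\max_{i\neq j}|L^{\dagger}_{ij}|$.
   Context: Chip-firing game: a configuration is a vector $\mathbf a\in\mathbb Z_{\ge 0}^n$ ($a_i$ chips on vertex $i$), with $N=\sum_i a_i$ chips. Vertex $i$ of degree $d_i$ may fire if $a_i\ge d_i$; firing moves one chip from $i$ to each neighbour of $i$. A terminating game is a finite sequence of legal firings starting from an initial configuration $\mathbf a$ and ending in a configuration $\mathbf b$ in which no vertex can fire. $L$ is the Laplacian of $G$ ($L_{ii}=d_i$, $L_{ij}=-1$ for adjacent $i\neq j$, $0$ otherwise) and $L^{\dagger}$ its Moore–Penrose pseudo-inverse (the unique $X$ with $LXL=L$, $XLX=X$, $LX$ and $XL$ symmetric). -}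

module Defs where

open import Data.Bool using (Bool; true; false; if_then_else_)
open import Data.Nat as ℕ using (ℕ; zero; suc; _∸_; _⊔_)
open import Data.Fin using (Fin; zero; suc; _≟_)
open import Data.List using (List; []; _∷_; length)
open import Data.Product using (∃; _×_; _,_)
open import Relation.Nullary using (does)
open import Relation.Binary.PropositionalEquality using (_≡_)
open import Data.Integer using (ℤ; +_)
open import Data.Rational as Q using (ℚ; 0ℚ; _/_)

-- Finite simple graphs on vertex set Fin n (vertex i ↔ paper's i+1)

record SimpleGraph (n : ℕ) : Set where
  field
    adj   : Fin n → Fin n → Bool
    sym   : ∀ i j → adj i j ≡ adj j i
    irrefl : ∀ i → adj i i ≡ false
open SimpleGraph public

∑ℕ : ∀ {n} → (Fin n → ℕ) → ℕ
∑ℕ {zero}  f = 0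
∑ℕ {suc n} f = f zero ℕ.+ ∑ℕ (λ i → f (suc i))

∑ℚ : ∀ {n} → (Fin n → ℚ) → ℚ
∑ℚ {zero}  f = 0ℚ
∑ℚ {suc n} f = f zero Q.+ ∑ℚ (λ i → f (suc i))

-- maxima over Fin n (value 0 for an empty index set)
maxℕ : ∀ {n} → (Fin n → ℕ) → ℕ
maxℕ {zero}  f = 0
maxℕ {suc n} f = f zero ⊔ maxℕ (λ i → f (suc i))

maxℚ : ∀ {n} → (Fin n → ℚ) → ℚ
maxℚ {zero}  f = 0ℚ
maxℚ {suc zero} f = f zero
maxℚ {suc (suc n)} f = f zero Q.⊔ maxℚ (λ i → f (suc i))

b2n : Bool → ℕ
b2n true  = 1
b2n false = 0

degree : ∀ {n} → SimpleGraph n → Fin n → ℕ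
degree G i = ∑ℕ (λ j → b2n (adj G i j))

maxDegree : ∀ {n} → SimpleGraph n → ℕ
maxDegree G = maxℕ (degree G)

data Reach {n} (G : SimpleGraph n) : Fin n → Fin n → Set where
  here : ∀ {i} → Reach G i i
  step : ∀ {i j k} → adj G i j ≡ true → Reach G j k → Reach G i k

Connected : ∀ {n} → SimpleGraph n → Set
Connected G = ∀ i j → Reach G i j

Config : ℕ → Set
Config n = Fin n → ℕ

chips : ∀ {n} → Config n → ℕ
chips a = ∑ℕ a

CanFire : ∀ {n} → SimpleGraph n → Config n → Fin n → Set
CanFire G a i = degree G i ℕ.≤ a i

fire : ∀ {n} → SimpleGraph n → Config n → Fin n → Config n
fire G a i j =
  if does (j ≟ i) then a i ∸ degree G i
  else (if adj G i j then suc (a j) else a j)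

data Game {n} (G : SimpleGraph n) : Config n → List (Fin n) → Config n → Set where
  done : ∀ {a} → Game G a [] a
  fires : ∀ {a i vs b} → CanFire G a i → Game G (fire G a i) vs b → Game G a (i ∷ vs) b

Stable : ∀ {n} → SimpleGraph n → Config n → Set
Stable G b = ∀ i → b i ℕ.< degree G i

count : ∀ {n} → Fin n → List (Fin n) → ℕ
count i [] = 0
count i (j ∷ vs) = (if does (i ≟ j) then 1 else 0) ℕ.+ count i vs

Matrix : ℕ → Set
Matrix n = Fin n → Fin n → ℚ

ℕtoℚ : ℕ → ℚ
ℕtoℚ m = (+ m) / 1

laplacian : ∀ {n} → SimpleGraph n → Matrix n
laplacian G i j =
  if does (i ≟ j) then ℕtoℚ (degree G i)
  else (if adj G i j then Q.- ℕtoℚ 1 else 0ℚ)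

_⊗_ : ∀ {n} → Matrix n → Matrix n → Matrix n
(A ⊗ B) i j = ∑ℚ (λ k → A i k Q.* B k j)

SymmetricM : ∀ {n} → Matrix n → Set
SymmetricM A = ∀ i j → A i j ≡ A j i

IsPseudoInverse : ∀ {n} → Matrix n → Matrix n → Set
IsPseudoInverse L X =
  (∀ i j → ((L ⊗ X) ⊗ L) i j ≡ L i j) ×
  (∀ i j → ((X ⊗ L) ⊗ X) i j ≡ X i j) ×
  SymmetricM (L ⊗ X) × SymmetricM (X ⊗ L)

maxDiag : ∀ {n} → Matrix n → ℚ
maxDiag X = maxℚ (λ i → X i i)

-- o = max_{i≠j} |X_ij|  (0 if there are no such pairs)
maxOffDiag : ∀ {n} → Matrix n → ℚ
maxOffDiag {zero} X = 0ℚ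
maxOffDiag {suc n} X =
  maxℚ (λ i → maxℚ (λ j → if does (i ≟ j) then 0ℚ else Q.∣ X i j ∣))

module Submission where

-- Let x be the firing vector of a game from a to b, so that s = ∑ x is its length, and let
-- L be the Laplacian; the rules of the game give L x = a - b.  If X is the Moore–Penrose
-- inverse of L, then u = X (a - b) also satisfies L u = a - b, so x - u lies in the kernel
-- of L, which on a connected graph consists of the constant vectors; moreover ∑ u = 0,
-- because X L is symmetric and annihilates constants.  Evaluating the constant x - u at a
-- vertex k that never fires gives the firing identity  s = n ∑ⱼ Xₖⱼ (bⱼ - aⱼ).  As L is
-- symmetric and positive semidefinite, so is X; hence 2|Xᵢⱼ| ≤ Xᵢᵢ + Xⱼⱼ and o ≤ f.
-- Bounding the k-th term by f (bₖ - aₖ) ≤ f (Δ - 1 - aₖ) and the others by o (aⱼ + bⱼ)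
-- yields the theorem.

open import Defs
open import Data.Nat using (ℕ)
open import Data.Fin using (Fin)
open import Data.List using (List; length)
open import Relation.Binary.PropositionalEquality using (_≡_)
open import Data.Rational using (_≤_; _+_; _-_; _*_)

open import Data.Nat as ℕ using (zero; suc)
import Data.Nat.Properties as ℕₚ
open import Data.Fin using (zero; suc; _≟_)
open import Data.List using ([]; _∷_)
open import Data.Bool using (true; false; if_then_else_)
open import Data.Product using (_,_; proj₁; proj₂)
open import Data.Sum using (inj₁; inj₂; [_,_]′)
open import Data.Empty using (⊥-elim)
open import Relation.Nullary using (does; yes; no; ¬_)
open import Relation.Binary.PropositionalEquality as ≡
  using (refl; trans; cong; cong₂; subst; module ≡-Reasoning)
open import Relation.Binary.Definitions using (tri<; tri≈; tri>)
open import Relation.Binary.Bundles using (Setoid)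
import Relation.Binary.Reasoning.Setoid as SetoidReasoning
import Data.Integer as ℤ
import Data.Integer.Properties as ℤₚ
import Data.Nat.Coprimality as Coprimality
open import Data.Rational
  using (ℚ; 0ℚ; 1ℚ; -_; ∣_∣; _/_; nonNegative; nonPositive; positive; negative)
open import Data.Rational.Properties hiding (_≟_)
open import Data.Rational.Solver using (module +-*-Solver)
open import Algebra.Bundles using (Ring)
import Algebra.Properties.Semiring.Sum (Ring.semiring +-*-ring) as Sum
open import Algebra.Properties.Group +-0-group using (x∙y⁻¹≈ε⇒x≈y)

open +-*-Solver using (solve; _:+_; _:-_; _:*_; :-_; _:=_; con)

-- Additivity holds because both sides are fractions over 1 once ℕtoℚ m and ℕtoℚ n are
-- written in normal form.
ℕtoℚ-+ : ∀ m n → ℕtoℚ (m ℕ.+ n) ≡ ℕtoℚ m + ℕtoℚ n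
ℕtoℚ-+ m n
  rewrite normalize-coprime (Coprimality.sym (Coprimality.1-coprimeTo m))
        | normalize-coprime (Coprimality.sym (Coprimality.1-coprimeTo n))
  = cong (_/ 1) (≡.sym numerators)
  where
  numerators : ℤ.+ m ℤ.* ℤ.+ 1 ℤ.+ ℤ.+ n ℤ.* ℤ.+ 1 ≡ ℤ.+ (m ℕ.+ n)
  numerators rewrite ℤₚ.*-identityʳ (ℤ.+ m) | ℤₚ.*-identityʳ (ℤ.+ n) = ≡.sym (ℤₚ.pos-+ m n)

ℕtoℚ-nonneg : ∀ m → 0ℚ ≤ ℕtoℚ m
ℕtoℚ-nonneg m = nonNegative⁻¹ (ℕtoℚ m) {{normalize-nonNeg m 1}}

ℕtoℚ-mono : ∀ {m n} → m ℕ.≤ n → ℕtoℚ m ≤ ℕtoℚ n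
ℕtoℚ-mono {m} {n} m≤n with ℕₚ.m≤n⇒∃[o]m+o≡n m≤n
... | d , refl = begin
  ℕtoℚ m            ≡⟨ ≡.sym (+-identityʳ _) ⟩
  ℕtoℚ m + 0ℚ       ≤⟨ +-monoʳ-≤ (ℕtoℚ m) (ℕtoℚ-nonneg d) ⟩
  ℕtoℚ m + ℕtoℚ d   ≡⟨ ≡.sym (ℕtoℚ-+ m d) ⟩
  ℕtoℚ (m ℕ.+ d)    ∎
  where open ≤-Reasoning

ℕtoℚ-∸ : ∀ {m n} → n ℕ.≤ m → ℕtoℚ (m ℕ.∸ n) ≡ ℕtoℚ m - ℕtoℚ n
ℕtoℚ-∸ {m} {n} n≤m = begin
  ℕtoℚ (m ℕ.∸ n)                    ≡⟨ solve 2 (λ d n → d := d :+ n :- n) refl _ (ℕtoℚ n) ⟩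
  ℕtoℚ (m ℕ.∸ n) + ℕtoℚ n - ℕtoℚ n  ≡⟨ cong (_- ℕtoℚ n) (≡.sym (ℕtoℚ-+ (m ℕ.∸ n) n)) ⟩
  ℕtoℚ (m ℕ.∸ n ℕ.+ n) - ℕtoℚ n     ≡⟨ cong (λ t → ℕtoℚ t - ℕtoℚ n) (ℕₚ.m∸n+n≡m n≤m) ⟩
  ℕtoℚ m - ℕtoℚ n                   ∎
  where open ≡-Reasoning

≤⇒0≤- : ∀ {p q} → p ≤ q → 0ℚ ≤ q - p
≤⇒0≤- {p} {q} p≤q = begin
  0ℚ     ≡⟨ ≡.sym (+-inverseʳ p) ⟩
  p - p  ≤⟨ +-monoˡ-≤ (- p) p≤q ⟩
  q - p  ∎
  where open ≤-Reasoning

0≤-⇒≤ : ∀ {p q} → 0ℚ ≤ q - p → p ≤ q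
0≤-⇒≤ {p} {q} 0≤q-p = begin
  p           ≡⟨ ≡.sym (+-identityˡ p) ⟩
  0ℚ + p      ≤⟨ +-monoˡ-≤ p 0≤q-p ⟩
  q - p + p   ≡⟨ solve 2 (λ p q → q :- p :+ p := q) refl p q ⟩
  q           ∎
  where open ≤-Reasoning

*-nonneg : ∀ {p q} → 0ℚ ≤ p → 0ℚ ≤ q → 0ℚ ≤ p * q
*-nonneg {p} {q} 0≤p 0≤q =
  nonNegative⁻¹ _ {{nonNeg*nonNeg⇒nonNeg p {{nonNegative 0≤p}} q {{nonNegative 0≤q}}}}

*-monoʳ-nonneg : ∀ {c p q} → 0ℚ ≤ c → p ≤ q → c * p ≤ c * q
*-monoʳ-nonneg {c} 0≤c = *-monoˡ-≤-nonNeg c {{nonNegative 0≤c}}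

square-nonneg : ∀ p → 0ℚ ≤ p * p
square-nonneg p with ≤-total 0ℚ p
... | inj₁ 0≤p = *-nonneg 0≤p 0≤p
... | inj₂ p≤0 = nonNegative⁻¹ _ {{nonPos*nonPos⇒nonPos p {{nonPositive p≤0}} p {{nonPositive p≤0}}}}

square-zero : ∀ p → p * p ≡ 0ℚ → p ≡ 0ℚ
square-zero p pp≡0 with <-cmp p 0ℚ
... | tri≈ _ p≡0 _ = p≡0
... | tri< p<0 _ _ =
  ⊥-elim (<-irrefl (≡.sym pp≡0) (positive⁻¹ _ {{neg*neg⇒pos p {{negative p<0}} p {{negative p<0}}}}))
... | tri> _ _ p>0 =
  ⊥-elim (<-irrefl (≡.sym pp≡0) (positive⁻¹ _ {{pos*pos⇒pos p {{positive p>0}} p {{positive p>0}}}}))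

double-reflects-≤ : ∀ {p q} → p + p ≤ q + q → p ≤ q
double-reflects-≤ {p} {q} 2p≤2q with <-cmp p q
... | tri< p<q _ _ = <⇒≤ p<q
... | tri≈ _ p≡q _ = ≤-reflexive p≡q
... | tri> _ _ q<p = ⊥-elim (<-irrefl refl (≤-<-trans 2p≤2q (+-mono-< q<p q<p)))

nonneg-+-zeroˡ : ∀ {p q} → 0ℚ ≤ p → 0ℚ ≤ q → p + q ≡ 0ℚ → p ≡ 0ℚ
nonneg-+-zeroˡ {p} {q} 0≤p 0≤q p+q≡0 = ≤-antisym p≤0 0≤p
  where
  open ≤-Reasoning
  p≤0 : p ≤ 0ℚ
  p≤0 = begin
    p       ≡⟨ ≡.sym (+-identityʳ p) ⟩
    p + 0ℚ  ≤⟨ +-monoʳ-≤ p 0≤q ⟩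
    p + q   ≡⟨ p+q≡0 ⟩
    0ℚ      ∎

p≤∣p∣ : ∀ p → p ≤ ∣ p ∣
p≤∣p∣ p with ≤-total 0ℚ p
... | inj₁ 0≤p = ≤-reflexive (≡.sym (0≤p⇒∣p∣≡p 0≤p))
... | inj₂ p≤0 = ≤-trans p≤0 (0≤∣p∣ p)

∑ℚ≡sum : ∀ {n} (f : Fin n → ℚ) → ∑ℚ f ≡ Sum.sum f
∑ℚ≡sum {zero}  f = refl
∑ℚ≡sum {suc n} f = cong (f zero +_) (∑ℚ≡sum (λ i → f (suc i)))

∑-cong : ∀ {n} {f g : Fin n → ℚ} → (∀ i → f i ≡ g i) → ∑ℚ f ≡ ∑ℚ g
∑-cong {zero}  f≗g = refl
∑-cong {suc n} f≗g = cong₂ _+_ (f≗g zero) (∑-cong (λ i → f≗g (suc i)))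

∑-+ : ∀ {n} (f g : Fin n → ℚ) → ∑ℚ (λ i → f i + g i) ≡ ∑ℚ f + ∑ℚ g
∑-+ f g = begin
  ∑ℚ (λ i → f i + g i)       ≡⟨ ∑ℚ≡sum (λ i → f i + g i) ⟩
  Sum.sum (λ i → f i + g i)  ≡⟨ Sum.∑-distrib-+ f g ⟩
  Sum.sum f + Sum.sum g      ≡⟨ ≡.sym (cong₂ _+_ (∑ℚ≡sum f) (∑ℚ≡sum g)) ⟩
  ∑ℚ f + ∑ℚ g                ∎
  where open ≡-Reasoning

∑-*ˡ : ∀ {n} (c : ℚ) (f : Fin n → ℚ) → ∑ℚ (λ i → c * f i) ≡ c * ∑ℚ f
∑-*ˡ c f = begin
  ∑ℚ (λ i → c * f i)       ≡⟨ ∑ℚ≡sum (λ i → c * f i) ⟩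
  Sum.sum (λ i → c * f i)  ≡⟨ ≡.sym (Sum.*-distribˡ-sum c f) ⟩
  c * Sum.sum f            ≡⟨ cong (c *_) (≡.sym (∑ℚ≡sum f)) ⟩
  c * ∑ℚ f                 ∎
  where open ≡-Reasoning

∑-*ʳ : ∀ {n} (c : ℚ) (f : Fin n → ℚ) → ∑ℚ (λ i → f i * c) ≡ ∑ℚ f * c
∑-*ʳ c f = trans (∑-cong (λ i → *-comm (f i) c)) (trans (∑-*ˡ c f) (*-comm c _))

∑-swap : ∀ {m n} (f : Fin m → Fin n → ℚ) →
         ∑ℚ (λ i → ∑ℚ (λ j → f i j)) ≡ ∑ℚ (λ j → ∑ℚ (λ i → f i j))
∑-swap f = begin
  ∑ℚ (λ i → ∑ℚ (λ j → f i j))           ≡⟨ double f ⟩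
  Sum.sum (λ i → Sum.sum (λ j → f i j)) ≡⟨ Sum.∑-comm f ⟩
  Sum.sum (λ j → Sum.sum (λ i → f i j)) ≡⟨ ≡.sym (double (λ j i → f i j)) ⟩
  ∑ℚ (λ j → ∑ℚ (λ i → f i j))           ∎
  where
  open ≡-Reasoning
  double : ∀ {m n} (g : Fin m → Fin n → ℚ) → ∑ℚ (λ i → ∑ℚ (g i)) ≡ Sum.sum (λ i → Sum.sum (g i))
  double g = trans (∑ℚ≡sum (λ i → ∑ℚ (g i))) (Sum.sum-cong-≗ (λ i → ∑ℚ≡sum (g i)))

∑-zero : ∀ {n} → ∑ℚ {n} (λ _ → 0ℚ) ≡ 0ℚ
∑-zero {n} = trans (∑ℚ≡sum {n} (λ _ → 0ℚ)) (Sum.sum-replicate-zero n)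

∑-- : ∀ {n} (f g : Fin n → ℚ) → ∑ℚ (λ i → f i - g i) ≡ ∑ℚ f - ∑ℚ g
∑-- f g = begin
  ∑ℚ (λ i → f i - g i)          ≡⟨ ∑-+ f (λ i → - g i) ⟩
  ∑ℚ f + ∑ℚ (λ i → - g i)       ≡⟨ cong (∑ℚ f +_) (∑-cong (λ i → neg-as-*  (g i))) ⟩
  ∑ℚ f + ∑ℚ (λ i → - 1ℚ * g i)  ≡⟨ cong (∑ℚ f +_) (∑-*ˡ (- 1ℚ) g) ⟩
  ∑ℚ f + - 1ℚ * ∑ℚ g            ≡⟨ cong (∑ℚ f +_) (≡.sym (neg-as-* (∑ℚ g))) ⟩
  ∑ℚ f - ∑ℚ g                   ∎
  where
  open ≡-Reasoning
  neg-as-* : ∀ p → - p ≡ - 1ℚ * p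
  neg-as-* p = solve 1 (λ p → :- p := con (- 1ℚ) :* p) refl p

∑-const : ∀ {n} (c : ℚ) → ∑ℚ {n} (λ _ → c) ≡ ℕtoℚ n * c
∑-const {zero}  c = ≡.sym (*-zeroˡ c)
∑-const {suc n} c = begin
  c + ∑ℚ {n} (λ _ → c)     ≡⟨ cong (c +_) (∑-const {n} c) ⟩
  c + ℕtoℚ n * c           ≡⟨ solve 2 (λ c m → c :+ m :* c := (con 1ℚ :+ m) :* c) refl c (ℕtoℚ n) ⟩
  (1ℚ + ℕtoℚ n) * c        ≡⟨ cong (_* c) (≡.sym (ℕtoℚ-+ 1 n)) ⟩
  ℕtoℚ (suc n) * c         ∎
  where open ≡-Reasoning

ℕtoℚ-∑ : ∀ {n} (f : Fin n → ℕ) → ℕtoℚ (∑ℕ f) ≡ ∑ℚ (λ i → ℕtoℚ (f i))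
ℕtoℚ-∑ {zero}  f = refl
ℕtoℚ-∑ {suc n} f = trans (ℕtoℚ-+ (f zero) _) (cong (ℕtoℚ (f zero) +_) (ℕtoℚ-∑ (λ i → f (suc i))))

∑-pick : ∀ {n} (i : Fin n) (g : Fin n → ℚ) → ∑ℚ (λ j → if does (j ≟ i) then g j else 0ℚ) ≡ g i
∑-pick {suc n} zero    g = trans (cong (g zero +_) (∑-zero {n})) (+-identityʳ _)
∑-pick {suc n} (suc i) g = trans (+-identityˡ _) (∑-pick i (λ j → g (suc j)))

∑-pick′ : ∀ {n} (i : Fin n) (g : Fin n → ℚ) → ∑ℚ (λ j → if does (i ≟ j) then g j else 0ℚ) ≡ g i
∑-pick′ {suc n} zero    g = trans (cong (g zero +_) (∑-zero {n})) (+-identityʳ _)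
∑-pick′ {suc n} (suc i) g = trans (+-identityˡ _) (∑-pick′ i (λ j → g (suc j)))

∑-mono : ∀ {n} {f g : Fin n → ℚ} → (∀ i → f i ≤ g i) → ∑ℚ f ≤ ∑ℚ g
∑-mono {zero}  f≤g = ≤-refl
∑-mono {suc n} f≤g = +-mono-≤ (f≤g zero) (∑-mono (λ i → f≤g (suc i)))

∑-nonneg : ∀ {n} {f : Fin n → ℚ} → (∀ i → 0ℚ ≤ f i) → 0ℚ ≤ ∑ℚ f
∑-nonneg {n} 0≤f = ≤-trans (≤-reflexive (≡.sym (∑-zero {n}))) (∑-mono 0≤f)

∑-nonneg-zero : ∀ {n} (f : Fin n → ℚ) → (∀ i → 0ℚ ≤ f i) → ∑ℚ f ≡ 0ℚ → ∀ i → f i ≡ 0ℚ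
∑-nonneg-zero {suc n} f 0≤f ∑≡0 zero = nonneg-+-zeroˡ (0≤f zero) (∑-nonneg (λ i → 0≤f (suc i))) ∑≡0
∑-nonneg-zero {suc n} f 0≤f ∑≡0 (suc i) =
  ∑-nonneg-zero (λ i → f (suc i)) (λ i → 0≤f (suc i))
    (nonneg-+-zeroˡ (∑-nonneg (λ i → 0≤f (suc i))) (0≤f zero) (trans (+-comm _ (f zero)) ∑≡0)) i

maxℚ-ub : ∀ {n} (g : Fin n → ℚ) i → g i ≤ maxℚ g
maxℚ-ub {suc zero}    g zero    = ≤-refl
maxℚ-ub {suc (suc n)} g zero    = p≤p⊔q (g zero) _
maxℚ-ub {suc (suc n)} g (suc i) = p≤q⇒p≤r⊔q (g zero) (maxℚ-ub (λ j → g (suc j)) i)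

maxℚ-lub : ∀ {n} (g : Fin (suc n) → ℚ) c → (∀ i → g i ≤ c) → maxℚ g ≤ c
maxℚ-lub {zero}  g c g≤c = g≤c zero
maxℚ-lub {suc n} g c g≤c = ⊔-lub (g≤c zero) (maxℚ-lub (λ j → g (suc j)) c (λ j → g≤c (suc j)))

maxℕ-ub : ∀ {n} (g : Fin n → ℕ) i → g i ℕ.≤ maxℕ g
maxℕ-ub {suc n} g zero    = ℕₚ.m≤m⊔n (g zero) _
maxℕ-ub {suc n} g (suc i) = ℕₚ.m≤n⇒m≤o⊔n (g zero) (maxℕ-ub (λ j → g (suc j)) i)

Vector : ℕ → Set
Vector n = Fin n → ℚ

_·_ : ∀ {n} → Matrix n → Vector n → Vector n
(M · v) i = ∑ℚ (λ j → M i j * v j)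

infixr 7 _·_

_+[_]_ : ∀ {n} → Vector n → ℚ → Vector n → Vector n
(u +[ c ] w) p = u p + c * w p

form : ∀ {n} → Matrix n → Vector n → Vector n → ℚ
form M u w = ∑ℚ (λ p → u p * (M · w) p)

·-assoc : ∀ {n} (M N : Matrix n) v i → (M · N · v) i ≡ ((M ⊗ N) · v) i
·-assoc M N v i = begin
  ∑ℚ (λ q → M i q * ∑ℚ (λ j → N q j * v j))
    ≡⟨ ∑-cong (λ q → ≡.sym (∑-*ˡ (M i q) (λ j → N q j * v j))) ⟩
  ∑ℚ (λ q → ∑ℚ (λ j → M i q * (N q j * v j)))
    ≡⟨ ∑-swap (λ q j → M i q * (N q j * v j)) ⟩
  ∑ℚ (λ j → ∑ℚ (λ q → M i q * (N q j * v j)))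
    ≡⟨ ∑-cong (λ j → trans (∑-cong (λ q → ≡.sym (*-assoc (M i q) (N q j) (v j))))
                           (∑-*ʳ (v j) (λ q → M i q * N q j))) ⟩
  ∑ℚ (λ j → (M ⊗ N) i j * v j)
    ∎
  where open ≡-Reasoning

·-linear : ∀ {n} (M : Matrix n) u c w i → (M · (u +[ c ] w)) i ≡ (M · u) i + c * (M · w) i
·-linear M u c w i = begin
  ∑ℚ (λ q → M i q * (u q + c * w q))
    ≡⟨ ∑-cong (λ q → solve 4 (λ m a c b → m :* (a :+ c :* b) := m :* a :+ c :* (m :* b))
                             refl (M i q) (u q) c (w q)) ⟩
  ∑ℚ (λ q → M i q * u q + c * (M i q * w q))
    ≡⟨ ∑-+ (λ q → M i q * u q) (λ q → c * (M i q * w q)) ⟩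
  (M · u) i + ∑ℚ (λ q → c * (M i q * w q))
    ≡⟨ cong ((M · u) i +_) (∑-*ˡ c (λ q → M i q * w q)) ⟩
  (M · u) i + c * (M · w) i
    ∎
  where open ≡-Reasoning

∑-· : ∀ {n} (M : Matrix n) → (∀ q → ∑ℚ (λ j → M j q) ≡ 0ℚ) → ∀ v → ∑ℚ (M · v) ≡ 0ℚ
∑-· {n} M colsum v = begin
  ∑ℚ (λ j → ∑ℚ (λ q → M j q * v q))
    ≡⟨ ∑-swap (λ j q → M j q * v q) ⟩
  ∑ℚ (λ q → ∑ℚ (λ j → M j q * v q))
    ≡⟨ ∑-cong (λ q → trans (∑-*ʳ (v q) (λ j → M j q)) (trans (cong (_* v q) (colsum q)) (*-zeroˡ (v q)))) ⟩
  ∑ℚ {n} (λ _ → 0ℚ)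
    ≡⟨ ∑-zero {n} ⟩
  0ℚ
    ∎
  where open ≡-Reasoning

sym-colsum : ∀ {n} (M : Matrix n) → SymmetricM M → (∀ i → (M · (λ _ → 1ℚ)) i ≡ 0ℚ) →
             ∀ q → ∑ℚ (λ j → M j q) ≡ 0ℚ
sym-colsum M M-sym M𝟙≡0 q = trans (∑-cong (λ j → trans (M-sym j q) (≡.sym (*-identityʳ (M q j))))) (M𝟙≡0 q)

form-linearˡ : ∀ {n} (M : Matrix n) u c w v → form M (u +[ c ] w) v ≡ form M u v + c * form M w v
form-linearˡ M u c w v = begin
  ∑ℚ (λ p → (u p + c * w p) * (M · v) p)
    ≡⟨ ∑-cong (λ p → solve 4 (λ a c b m → (a :+ c :* b) :* m := a :* m :+ c :* (b :* m))
                             refl (u p) c (w p) ((M · v) p)) ⟩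
  ∑ℚ (λ p → u p * (M · v) p + c * (w p * (M · v) p))
    ≡⟨ ∑-+ (λ p → u p * (M · v) p) (λ p → c * (w p * (M · v) p)) ⟩
  form M u v + ∑ℚ (λ p → c * (w p * (M · v) p))
    ≡⟨ cong (form M u v +_) (∑-*ˡ c (λ p → w p * (M · v) p)) ⟩
  form M u v + c * form M w v
    ∎
  where open ≡-Reasoning

form-linearʳ : ∀ {n} (M : Matrix n) v u c w → form M v (u +[ c ] w) ≡ form M v u + c * form M v w
form-linearʳ M v u c w = begin
  ∑ℚ (λ p → v p * (M · (u +[ c ] w)) p)
    ≡⟨ ∑-cong (λ p → cong (v p *_) (·-linear M u c w p)) ⟩
  ∑ℚ (λ p → v p * ((M · u) p + c * (M · w) p))
    ≡⟨ ∑-cong (λ p → solve 4 (λ a l c m → a :* (l :+ c :* m) := a :* l :+ c :* (a :* m))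
                             refl (v p) ((M · u) p) c ((M · w) p)) ⟩
  ∑ℚ (λ p → v p * (M · u) p + c * (v p * (M · w) p))
    ≡⟨ ∑-+ (λ p → v p * (M · u) p) (λ p → c * (v p * (M · w) p)) ⟩
  form M v u + ∑ℚ (λ p → c * (v p * (M · w) p))
    ≡⟨ cong (form M v u +_) (∑-*ˡ c (λ p → v p * (M · w) p)) ⟩
  form M v u + c * form M v w
    ∎
  where open ≡-Reasoning

form-sym : ∀ {n} (M : Matrix n) → SymmetricM M → ∀ u w → form M u w ≡ form M w u
form-sym M M-sym u w = begin
  ∑ℚ (λ p → u p * ∑ℚ (λ q → M p q * w q))     ≡⟨ ∑-cong (λ p → ≡.sym (∑-*ˡ (u p) (λ q → M p q * w q))) ⟩
  ∑ℚ (λ p → ∑ℚ (λ q → u p * (M p q * w q)))   ≡⟨ ∑-swap (λ p q → u p * (M p q * w q)) ⟩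
  ∑ℚ (λ q → ∑ℚ (λ p → u p * (M p q * w q)))   ≡⟨ ∑-cong (λ q → ∑-cong (λ p → swap-factors p q)) ⟩
  ∑ℚ (λ q → ∑ℚ (λ p → w q * (M q p * u p)))   ≡⟨ ∑-cong (λ q → ∑-*ˡ (w q) (λ p → M q p * u p)) ⟩
  ∑ℚ (λ q → w q * ∑ℚ (λ p → M q p * u p))     ∎
  where
  open ≡-Reasoning
  swap-factors : ∀ p q → u p * (M p q * w q) ≡ w q * (M q p * u p)
  swap-factors p q = trans (cong (λ m → u p * (m * w q)) (M-sym p q))
                           (solve 3 (λ a m b → a :* (m :* b) := b :* (m :* a)) refl (u p) (M q p) (w q))

form-expand : ∀ {n} (M : Matrix n) → SymmetricM M → ∀ u c w →
              form M (u +[ c ] w) (u +[ c ] w)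
                ≡ form M u u + c * (form M u w + form M u w) + c * c * form M w w
form-expand M M-sym u c w = begin
  form M (u +[ c ] w) (u +[ c ] w)
    ≡⟨ form-linearˡ M u c w (u +[ c ] w) ⟩
  form M u (u +[ c ] w) + c * form M w (u +[ c ] w)
    ≡⟨ cong₂ (λ s t → s + c * t) (form-linearʳ M u u c w) (form-linearʳ M w u c w) ⟩
  form M u u + c * form M u w + c * (form M w u + c * form M w w)
    ≡⟨ cong (λ t → form M u u + c * form M u w + c * (t + c * form M w w)) (form-sym M M-sym w u) ⟩
  form M u u + c * form M u w + c * (form M u w + c * form M w w)
    ≡⟨ solve 4 (λ A B C c → A :+ c :* B :+ c :* (B :+ c :* C) := A :+ c :* (B :+ B) :+ c :* c :* C)
               refl (form M u u) (form M u w) (form M w w) c ⟩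
  form M u u + c * (form M u w + form M u w) + c * c * form M w w
    ∎
  where open ≡-Reasoning

-- Cauchy–Schwarz-type bound for a positive semidefinite symmetric form:
-- 2 |uᵀMw| ≤ uᵀMu + wᵀMw, read off from the forms of u - w (if uᵀMw ≥ 0) and u + w.
psd-cross-bound : ∀ {n} (M : Matrix n) → SymmetricM M → (∀ v → 0ℚ ≤ form M v v) →
                  ∀ u w → ∣ form M u w ∣ + ∣ form M u w ∣ ≤ form M u u + form M w w
psd-cross-bound M M-sym psd u w = [ via-difference , via-sum ]′ (∣p∣≡p∨∣p∣≡-p t)
  where
  A t C : ℚ
  A = form M u u
  t = form M u w
  C = form M w w

  along : ∀ c → 0ℚ ≤ A + c * (t + t) + c * c * C
  along c = ≤-trans (psd (u +[ c ] w)) (≤-reflexive (form-expand M M-sym u c w))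

  via-difference : ∣ t ∣ ≡ t → ∣ t ∣ + ∣ t ∣ ≤ A + C
  via-difference ∣t∣≡t = subst (λ s → s + s ≤ A + C) (≡.sym ∣t∣≡t) (0≤-⇒≤ (≤-trans (along (- 1ℚ))
    (≤-reflexive (solve 3 (λ A t C → A :+ con (- 1ℚ) :* (t :+ t) :+ con (- 1ℚ) :* con (- 1ℚ) :* C
                                      := A :+ C :- (t :+ t)) refl A t C))))

  via-sum : ∣ t ∣ ≡ - t → ∣ t ∣ + ∣ t ∣ ≤ A + C
  via-sum ∣t∣≡-t = subst (λ s → s + s ≤ A + C) (≡.sym ∣t∣≡-t) (0≤-⇒≤ (≤-trans (along 1ℚ)
    (≤-reflexive (solve 3 (λ A t C → A :+ con 1ℚ :* (t :+ t) :+ con 1ℚ :* con 1ℚ :* C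
                                      := A :+ C :- (:- t :+ :- t)) refl A t C))))

⊗-assoc : ∀ {n} (M N P : Matrix n) i j → ((M ⊗ N) ⊗ P) i j ≡ (M ⊗ (N ⊗ P)) i j
⊗-assoc M N P i j = begin
  ∑ℚ (λ k → ∑ℚ (λ l → M i l * N l k) * P k j)
    ≡⟨ ∑-cong (λ k → ≡.sym (∑-*ʳ (P k j) (λ l → M i l * N l k))) ⟩
  ∑ℚ (λ k → ∑ℚ (λ l → M i l * N l k * P k j))
    ≡⟨ ∑-swap (λ k l → M i l * N l k * P k j) ⟩
  ∑ℚ (λ l → ∑ℚ (λ k → M i l * N l k * P k j))
    ≡⟨ ∑-cong (λ l → trans (∑-cong (λ k → *-assoc (M i l) (N l k) (P k j))) (∑-*ˡ (M i l) (λ k → N l k * P k j))) ⟩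
  ∑ℚ (λ l → M i l * ∑ℚ (λ k → N l k * P k j))
    ∎
  where open ≡-Reasoning

_≈_ : ∀ {n} → Matrix n → Matrix n → Set
M ≈ N = ∀ i j → M i j ≡ N i j

matrixSetoid : ℕ → Setoid _ _
matrixSetoid n = record
  { Carrier       = Matrix n
  ; _≈_           = _≈_
  ; isEquivalence = record
    { refl  = λ i j → refl
    ; sym   = λ M≈N i j → ≡.sym (M≈N i j)
    ; trans = λ M≈N N≈P i j → trans (M≈N i j) (N≈P i j)
    }
  }

⊗-cong : ∀ {n} {M M′ N N′ : Matrix n} → M ≈ M′ → N ≈ N′ → (M ⊗ N) ≈ (M′ ⊗ N′)
⊗-cong M≈M′ N≈N′ i j = ∑-cong (λ k → cong₂ _*_ (M≈M′ i k) (N≈N′ k j))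

_ᵀ : ∀ {n} → Matrix n → Matrix n
(M ᵀ) i j = M j i

infix 30 _ᵀ

ᵀ-⊗ : ∀ {n} (M N : Matrix n) → ((M ⊗ N) ᵀ) ≈ (N ᵀ ⊗ M ᵀ)
ᵀ-⊗ M N i j = ∑-cong (λ k → *-comm (M j k) (N k i))

module PseudoInverse {n} {L X : Matrix n} (L-sym : SymmetricM L) (pinv : IsPseudoInverse L X) where

  LXL≈L : ((L ⊗ X) ⊗ L) ≈ L
  LXL≈L = proj₁ pinv

  XLX≈X : ((X ⊗ L) ⊗ X) ≈ X
  XLX≈X = proj₁ (proj₂ pinv)

  LX-sym : SymmetricM (L ⊗ X)
  LX-sym = proj₁ (proj₂ (proj₂ pinv))

  XL-sym : SymmetricM (X ⊗ L)
  XL-sym = proj₂ (proj₂ (proj₂ pinv))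

  open Setoid (matrixSetoid n) using () renaming (refl to ≈-refl; sym to ≈-sym)
  module ≈-Reasoning = SetoidReasoning (matrixSetoid n)

  Lᵀ≈L : (L ᵀ) ≈ L
  Lᵀ≈L i j = L-sym j i

  -- Xᵀ is again a Moore–Penrose inverse of L; the classical uniqueness argument
  -- then shows X = X L Xᵀ = Xᵀ, i.e. X is symmetric.
  XᵀL≈LX : (X ᵀ ⊗ L) ≈ (L ⊗ X)
  XᵀL≈LX i j = trans (∑-cong (λ k → trans (*-comm (X k i) (L k j)) (cong (_* X k i) (L-sym k j)))) (≡.sym (LX-sym i j))

  LXᵀ≈XL : (L ⊗ X ᵀ) ≈ (X ⊗ L)
  LXᵀ≈XL i j = trans (∑-cong (λ k → trans (*-comm (L i k) (X j k)) (cong (X j k *_) (L-sym i k)))) (≡.sym (XL-sym i j))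

  LXᵀL≈L : ((L ⊗ X ᵀ) ⊗ L) ≈ L
  LXᵀL≈L = begin
    (L ⊗ X ᵀ) ⊗ L          ≈⟨ ⊗-cong (⊗-cong {N = X ᵀ} (≈-sym Lᵀ≈L) ≈-refl) (≈-sym Lᵀ≈L) ⟩
    (L ᵀ ⊗ X ᵀ) ⊗ L ᵀ      ≈⟨ ⊗-cong {N = L ᵀ} (≈-sym (ᵀ-⊗ X L)) ≈-refl ⟩
    (X ⊗ L) ᵀ ⊗ L ᵀ        ≈⟨ ≈-sym (ᵀ-⊗ L (X ⊗ L)) ⟩
    (L ⊗ (X ⊗ L)) ᵀ        ≈⟨ (λ i j → ≡.sym (⊗-assoc L X L j i)) ⟩
    ((L ⊗ X) ⊗ L) ᵀ        ≈⟨ (λ i j → LXL≈L j i) ⟩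
    L ᵀ                    ≈⟨ Lᵀ≈L ⟩
    L                      ∎
    where open ≈-Reasoning

  XᵀLXᵀ≈Xᵀ : ((X ᵀ ⊗ L) ⊗ X ᵀ) ≈ X ᵀ
  XᵀLXᵀ≈Xᵀ = begin
    (X ᵀ ⊗ L) ⊗ X ᵀ        ≈⟨ ⊗-cong {N = X ᵀ} (⊗-cong {M = X ᵀ} ≈-refl (≈-sym Lᵀ≈L)) ≈-refl ⟩
    (X ᵀ ⊗ L ᵀ) ⊗ X ᵀ      ≈⟨ ⊗-cong {N = X ᵀ} (≈-sym (ᵀ-⊗ L X)) ≈-refl ⟩
    (L ⊗ X) ᵀ ⊗ X ᵀ        ≈⟨ ≈-sym (ᵀ-⊗ X (L ⊗ X)) ⟩
    (X ⊗ (L ⊗ X)) ᵀ        ≈⟨ (λ i j → ≡.sym (⊗-assoc X L X j i)) ⟩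
    ((X ⊗ L) ⊗ X) ᵀ        ≈⟨ (λ i j → XLX≈X j i) ⟩
    X ᵀ                    ∎
    where open ≈-Reasoning

  X≈XLXᵀ : X ≈ (X ⊗ (L ⊗ X ᵀ))
  X≈XLXᵀ = begin
    X                                   ≈⟨ ≈-sym XLX≈X ⟩
    (X ⊗ L) ⊗ X                         ≈⟨ ⊗-assoc X L X ⟩
    X ⊗ (L ⊗ X)                         ≈⟨ ⊗-cong {M = X} ≈-refl (≈-sym XᵀL≈LX) ⟩
    X ⊗ (X ᵀ ⊗ L)                       ≈⟨ ⊗-cong {M = X} ≈-refl (⊗-cong {M = X ᵀ} ≈-refl (≈-sym LXL≈L)) ⟩
    X ⊗ (X ᵀ ⊗ ((L ⊗ X) ⊗ L))           ≈⟨ ⊗-cong {M = X} ≈-refl (⊗-cong {M = X ᵀ} ≈-refl (⊗-assoc L X L)) ⟩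
    X ⊗ (X ᵀ ⊗ (L ⊗ (X ⊗ L)))           ≈⟨ ⊗-cong {M = X} ≈-refl (≈-sym (⊗-assoc (X ᵀ) L (X ⊗ L))) ⟩
    X ⊗ ((X ᵀ ⊗ L) ⊗ (X ⊗ L))           ≈⟨ ⊗-cong {M = X} ≈-refl (⊗-cong XᵀL≈LX (≈-sym LXᵀ≈XL)) ⟩
    X ⊗ ((L ⊗ X) ⊗ (L ⊗ X ᵀ))           ≈⟨ ≈-sym (⊗-assoc X (L ⊗ X) (L ⊗ X ᵀ)) ⟩
    (X ⊗ (L ⊗ X)) ⊗ (L ⊗ X ᵀ)           ≈⟨ ⊗-cong {N = L ⊗ X ᵀ} (≈-sym (⊗-assoc X L X)) ≈-refl ⟩
    ((X ⊗ L) ⊗ X) ⊗ (L ⊗ X ᵀ)           ≈⟨ ⊗-cong {N = L ⊗ X ᵀ} XLX≈X ≈-refl ⟩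
    X ⊗ (L ⊗ X ᵀ)                       ∎
    where open ≈-Reasoning

  Xᵀ≈XLXᵀ : (X ᵀ) ≈ (X ⊗ (L ⊗ X ᵀ))
  Xᵀ≈XLXᵀ = begin
    X ᵀ                                 ≈⟨ ≈-sym XᵀLXᵀ≈Xᵀ ⟩
    (X ᵀ ⊗ L) ⊗ X ᵀ                     ≈⟨ ⊗-cong {N = X ᵀ} XᵀL≈LX ≈-refl ⟩
    (L ⊗ X) ⊗ X ᵀ                       ≈⟨ ⊗-cong {N = X ᵀ} (⊗-cong {N = X} (≈-sym LXᵀL≈L) ≈-refl) ≈-refl ⟩
    (((L ⊗ X ᵀ) ⊗ L) ⊗ X) ⊗ X ᵀ         ≈⟨ ⊗-cong {N = X ᵀ} (⊗-assoc (L ⊗ X ᵀ) L X) ≈-refl ⟩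
    ((L ⊗ X ᵀ) ⊗ (L ⊗ X)) ⊗ X ᵀ         ≈⟨ ⊗-cong {N = X ᵀ} (⊗-cong LXᵀ≈XL (≈-sym XᵀL≈LX)) ≈-refl ⟩
    ((X ⊗ L) ⊗ (X ᵀ ⊗ L)) ⊗ X ᵀ         ≈⟨ ⊗-assoc (X ⊗ L) (X ᵀ ⊗ L) (X ᵀ) ⟩
    (X ⊗ L) ⊗ ((X ᵀ ⊗ L) ⊗ X ᵀ)         ≈⟨ ⊗-cong {M = X ⊗ L} ≈-refl XᵀLXᵀ≈Xᵀ ⟩
    (X ⊗ L) ⊗ X ᵀ                       ≈⟨ ⊗-assoc X L (X ᵀ) ⟩
    X ⊗ (L ⊗ X ᵀ)                       ∎
    where open ≈-Reasoning

  X-sym : SymmetricM X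
  X-sym i j = trans (X≈XLXᵀ i j) (≡.sym (Xᵀ≈XLXᵀ i j))

  -- X is the Gram matrix of its own rows with respect to the form of L.
  X-gram : ∀ i j → X i j ≡ form L (X i) (X j)
  X-gram i j = trans (≡.sym (XLX≈X i j)) (trans (⊗-assoc X L X i j)
                 (∑-cong (λ p → cong (X i p *_) (∑-cong (λ q → cong (L p q *_) (X-sym q j))))))

  -- Hence, when L is positive semidefinite, so is X.
  module _ (L-psd : ∀ v → 0ℚ ≤ form L v v) where

    X-diag-nonneg : ∀ i → 0ℚ ≤ X i i
    X-diag-nonneg i = ≤-trans (L-psd (X i)) (≤-reflexive (≡.sym (X-gram i i)))

    X-offdiag-bound : ∀ i j → ∣ X i j ∣ + ∣ X i j ∣ ≤ X i i + X j j
    X-offdiag-bound i j = begin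
      ∣ X i j ∣ + ∣ X i j ∣                                   ≡⟨ cong (λ t → ∣ t ∣ + ∣ t ∣) (X-gram i j) ⟩
      ∣ form L (X i) (X j) ∣ + ∣ form L (X i) (X j) ∣         ≤⟨ psd-cross-bound L L-sym L-psd (X i) (X j) ⟩
      form L (X i) (X i) + form L (X j) (X j)                 ≡⟨ ≡.sym (cong₂ _+_ (X-gram i i) (X-gram j j)) ⟩
      X i i + X j j                                           ∎
      where open ≤-Reasoning

  -- L annihilates constants ⇒ X L does, and X L is symmetric ⇒ its columns sum to zero.
  XL-colsum : (∀ i → (L · (λ _ → 1ℚ)) i ≡ 0ℚ) → ∀ q → ∑ℚ (λ j → (X ⊗ L) j q) ≡ 0ℚ
  XL-colsum L𝟙≡0 = sym-colsum (X ⊗ L) XL-sym XL𝟙≡0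
    where
    XL𝟙≡0 : ∀ i → ((X ⊗ L) · (λ _ → 1ℚ)) i ≡ 0ℚ
    XL𝟙≡0 i = trans (≡.sym (·-assoc X L (λ _ → 1ℚ) i))
                (trans (∑-cong (λ j → trans (cong (X i j *_) (L𝟙≡0 j)) (*-zeroʳ (X i j)))) (∑-zero {n}))

module Laplacian {n} (G : SimpleGraph n) where

  L : Matrix n
  L = laplacian G

  edge : Fin n → Fin n → ℚ
  edge i j = ℕtoℚ (b2n (adj G i j))

  edge-sym : ∀ i j → edge i j ≡ edge j i
  edge-sym i j = cong (λ e → ℕtoℚ (b2n e)) (SimpleGraph.sym G i j)

  edge-nonneg : ∀ i j → 0ℚ ≤ edge i j
  edge-nonneg i j = ℕtoℚ-nonneg (b2n (adj G i j))

  degree-∑ : ∀ i → ℕtoℚ (degree G i) ≡ ∑ℚ (edge i)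
  degree-∑ i = ℕtoℚ-∑ (λ j → b2n (adj G i j))

  L-sym : SymmetricM L
  L-sym i j with i ≟ j | j ≟ i
  ... | yes refl | yes _    = refl
  ... | yes refl | no i≢i   = ⊥-elim (i≢i refl)
  ... | no i≢i   | yes refl = ⊥-elim (i≢i refl)
  ... | no _     | no _     rewrite SimpleGraph.sym G i j = refl

  L-entry : ∀ i j c → L i j * c ≡ (if does (i ≟ j) then ℕtoℚ (degree G i) * c else 0ℚ) - edge i j * c
  L-entry i j c with i ≟ j
  ... | yes refl rewrite SimpleGraph.irrefl G i =
    solve 2 (λ d c → d :* c := d :* c :- con 0ℚ :* c) refl (ℕtoℚ (degree G i)) c
  ... | no _ with adj G i j
  ...   | true  = solve 1 (λ c → con (- 1ℚ) :* c := con 0ℚ :- con 1ℚ :* c) refl c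
  ...   | false = solve 1 (λ c → con 0ℚ :* c := con 0ℚ :- con 0ℚ :* c) refl c

  L-apply : ∀ v i → (L · v) i ≡ ∑ℚ (λ j → edge i j * (v i - v j))
  L-apply v i = begin
    ∑ℚ (λ j → L i j * v j)
      ≡⟨ ∑-cong (λ j → L-entry i j (v j)) ⟩
    ∑ℚ (λ j → diagonal j - edge i j * v j)
      ≡⟨ ∑-- diagonal (λ j → edge i j * v j) ⟩
    ∑ℚ diagonal - ∑ℚ (λ j → edge i j * v j)
      ≡⟨ cong (_- ∑ℚ (λ j → edge i j * v j)) degree-term ⟩
    ∑ℚ (λ j → edge i j * v i) - ∑ℚ (λ j → edge i j * v j)
      ≡⟨ ≡.sym (∑-- (λ j → edge i j * v i) (λ j → edge i j * v j)) ⟩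
    ∑ℚ (λ j → edge i j * v i - edge i j * v j)
      ≡⟨ ∑-cong (λ j → solve 3 (λ a x y → a :* x :- a :* y := a :* (x :- y)) refl (edge i j) (v i) (v j)) ⟩
    ∑ℚ (λ j → edge i j * (v i - v j))
      ∎
    where
    open ≡-Reasoning
    diagonal : Vector n
    diagonal j = if does (i ≟ j) then ℕtoℚ (degree G i) * v j else 0ℚ

    degree-term : ∑ℚ diagonal ≡ ∑ℚ (λ j → edge i j * v i)
    degree-term = trans (∑-pick′ i (λ j → ℕtoℚ (degree G i) * v j))
                        (trans (cong (_* v i) (degree-∑ i)) (≡.sym (∑-*ʳ (v i) (edge i))))

  L-constant : ∀ i → (L · (λ _ → 1ℚ)) i ≡ 0ℚ
  L-constant i = trans (L-apply (λ _ → 1ℚ) i)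
    (trans (∑-cong (λ j → trans (cong (edge i j *_) (+-inverseʳ 1ℚ)) (*-zeroʳ (edge i j)))) (∑-zero {n}))

  L-colsum : ∀ q → ∑ℚ (λ j → L j q) ≡ 0ℚ
  L-colsum = sym-colsum L L-sym L-constant

  energy-term : Vector n → Fin n → Fin n → ℚ
  energy-term u p q = edge p q * ((u p - u q) * (u p - u q))

  energy : Vector n → ℚ
  energy u = ∑ℚ (λ p → ∑ℚ (λ q → energy-term u p q))

  energy-term-nonneg : ∀ u p q → 0ℚ ≤ energy-term u p q
  energy-term-nonneg u p q = *-nonneg (edge-nonneg p q) (square-nonneg (u p - u q))

  -- The Dirichlet identity 2 uᵀ L u = energy u: expand with L-apply and symmetrise in (p, q).
  L-dirichlet : ∀ u → form L u u + form L u u ≡ energy u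
  L-dirichlet u = begin
    form L u u + form L u u
      ≡⟨ cong₂ _+_ expand (trans expand (∑-swap t)) ⟩
    ∑ℚ (λ p → ∑ℚ (λ q → t p q)) + ∑ℚ (λ p → ∑ℚ (λ q → t q p))
      ≡⟨ ≡.sym (∑-+ (λ p → ∑ℚ (λ q → t p q)) (λ p → ∑ℚ (λ q → t q p))) ⟩
    ∑ℚ (λ p → ∑ℚ (λ q → t p q) + ∑ℚ (λ q → t q p))
      ≡⟨ ∑-cong (λ p → ≡.sym (∑-+ (λ q → t p q) (λ q → t q p))) ⟩
    ∑ℚ (λ p → ∑ℚ (λ q → t p q + t q p))
      ≡⟨ ∑-cong (λ p → ∑-cong (λ q → symmetrise p q)) ⟩
    energy u
      ∎
    where
    open ≡-Reasoning
    t : Fin n → Fin n → ℚ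
    t p q = edge p q * (u p * (u p - u q))

    expand : form L u u ≡ ∑ℚ (λ p → ∑ℚ (λ q → t p q))
    expand = ∑-cong (λ p → trans (cong (u p *_) (L-apply u p))
               (trans (≡.sym (∑-*ˡ (u p) (λ q → edge p q * (u p - u q))))
                 (∑-cong (λ q → solve 3 (λ x a d → x :* (a :* d) := a :* (x :* d)) refl (u p) (edge p q) (u p - u q)))))

    symmetrise : ∀ p q → t p q + t q p ≡ energy-term u p q
    symmetrise p q = trans (cong (λ e → t p q + e * (u q * (u q - u p))) (edge-sym q p))
      (solve 3 (λ a x y → a :* (x :* (x :- y)) :+ a :* (y :* (y :- x)) := a :* ((x :- y) :* (x :- y)))
             refl (edge p q) (u p) (u q))

  L-psd : ∀ u → 0ℚ ≤ form L u u
  L-psd u = double-reflects-≤ (≤-trans (≤-reflexive (+-identityʳ 0ℚ))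
    (≤-trans (∑-nonneg (λ p → ∑-nonneg (energy-term-nonneg u p))) (≤-reflexive (≡.sym (L-dirichlet u)))))

  -- On a connected graph the kernel of L consists of the constant vectors:
  -- L z = 0 forces the energy of z, hence every energy term, to vanish,
  -- so z agrees across every edge and therefore along every path.
  L-kernel : Connected G → ∀ z → (∀ p → (L · z) p ≡ 0ℚ) → ∀ i j → z i ≡ z j
  L-kernel connected z Lz≡0 i j = along (connected i j)
    where
    form≡0 : form L z z ≡ 0ℚ
    form≡0 = trans (∑-cong (λ p → trans (cong (z p *_) (Lz≡0 p)) (*-zeroʳ (z p)))) (∑-zero {n})

    terms≡0 : ∀ p q → energy-term z p q ≡ 0ℚ
    terms≡0 p = ∑-nonneg-zero (energy-term z p) (energy-term-nonneg z p)
                  (∑-nonneg-zero _ (λ p → ∑-nonneg (energy-term-nonneg z p))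
                    (trans (≡.sym (L-dirichlet z)) (cong₂ _+_ form≡0 form≡0)) p)

    across-edge : ∀ {p q} → adj G p q ≡ true → z p ≡ z q
    across-edge {p} {q} p~q = x∙y⁻¹≈ε⇒x≈y (z p) (z q) (square-zero (z p - z q) (trans (≡.sym (*-identityˡ _))
      (subst (λ e → ℕtoℚ (b2n e) * ((z p - z q) * (z p - z q)) ≡ 0ℚ) p~q (terms≡0 p q))))

    along : ∀ {i j} → Reach G i j → z i ≡ z j
    along here            = refl
    along (step i~k path) = trans (across-edge i~k) (along path)

module ChipFiring {n} (G : SimpleGraph n) where
  open Laplacian G

  ⟦_⟧ : Config n → Vector n
  ⟦ a ⟧ i = ℕtoℚ (a i)

  firings : List (Fin n) → Vector n
  firings vs i = ℕtoℚ (count i vs)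

  firings-∷ : ∀ i vs j → firings (i ∷ vs) j ≡ (if does (j ≟ i) then 1ℚ else 0ℚ) + firings vs j
  firings-∷ i vs j = trans (ℕtoℚ-+ (if does (j ≟ i) then 1 else 0) (count j vs))
                           (cong (_+ firings vs j) (cast-indicator (does (j ≟ i))))
    where
    cast-indicator : ∀ e → ℕtoℚ (if e then 1 else 0) ≡ (if e then 1ℚ else 0ℚ)
    cast-indicator true  = refl
    cast-indicator false = refl

  firings-total : ∀ vs → ∑ℚ (firings vs) ≡ ℕtoℚ (length vs)
  firings-total []       = ∑-zero {n}
  firings-total (i ∷ vs) = begin
    ∑ℚ (firings (i ∷ vs))
      ≡⟨ ∑-cong (firings-∷ i vs) ⟩
    ∑ℚ (λ j → (if does (j ≟ i) then 1ℚ else 0ℚ) + firings vs j)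
      ≡⟨ ∑-+ (λ j → if does (j ≟ i) then 1ℚ else 0ℚ) (firings vs) ⟩
    ∑ℚ (λ j → if does (j ≟ i) then 1ℚ else 0ℚ) + ∑ℚ (firings vs)
      ≡⟨ cong₂ _+_ (∑-pick i (λ _ → 1ℚ)) (firings-total vs) ⟩
    1ℚ + ℕtoℚ (length vs)
      ≡⟨ ≡.sym (ℕtoℚ-+ 1 (length vs)) ⟩
    ℕtoℚ (length (i ∷ vs))
      ∎
    where open ≡-Reasoning

  L-firings-∷ : ∀ i vs j → (L · firings (i ∷ vs)) j ≡ L j i + (L · firings vs) j
  L-firings-∷ i vs j = begin
    ∑ℚ (λ q → L j q * firings (i ∷ vs) q)
      ≡⟨ ∑-cong (λ q → trans (cong (L j q *_) (firings-∷ i vs q)) (distribute (does (q ≟ i)) (L j q) (firings vs q))) ⟩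
    ∑ℚ (λ q → (if does (q ≟ i) then L j q else 0ℚ) + L j q * firings vs q)
      ≡⟨ ∑-+ (λ q → if does (q ≟ i) then L j q else 0ℚ) (λ q → L j q * firings vs q) ⟩
    ∑ℚ (λ q → if does (q ≟ i) then L j q else 0ℚ) + (L · firings vs) j
      ≡⟨ cong (_+ (L · firings vs) j) (∑-pick i (L j)) ⟩
    L j i + (L · firings vs) j
      ∎
    where
    open ≡-Reasoning
    distribute : ∀ e l x → l * ((if e then 1ℚ else 0ℚ) + x) ≡ (if e then l else 0ℚ) + l * x
    distribute true  l x = solve 2 (λ l x → l :* (con 1ℚ :+ x) := l :+ l :* x) refl l x
    distribute false l x = solve 2 (λ l x → l :* (con 0ℚ :+ x) := con 0ℚ :+ l :* x) refl l x

  fire-effect : ∀ a i → CanFire G a i → ∀ j → ℕtoℚ (fire G a i j) ≡ ℕtoℚ (a j) - L j i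
  fire-effect a i canFire j with j ≟ i
  ... | yes refl = ℕtoℚ-∸ canFire
  ... | no _ rewrite SimpleGraph.sym G j i with adj G i j
  ...   | true  = trans (ℕtoℚ-+ 1 (a j)) (+-comm 1ℚ (ℕtoℚ (a j)))
  ...   | false = ≡.sym (+-identityʳ (ℕtoℚ (a j)))

  game-equation : ∀ {a vs b} → Game G a vs b → ∀ j → ℕtoℚ (a j) - ℕtoℚ (b j) ≡ (L · firings vs) j
  game-equation {a} done j =
    trans (+-inverseʳ (ℕtoℚ (a j))) (≡.sym (trans (∑-cong (λ q → *-zeroʳ (L j q))) (∑-zero {n})))
  game-equation {a} {i ∷ vs} {b} (fires canFire game) j = begin
    ℕtoℚ (a j) - ℕtoℚ (b j)
      ≡⟨ solve 3 (λ x y z → x :- z := (x :- y) :+ (y :- z)) refl (ℕtoℚ (a j)) (ℕtoℚ (fire G a i j)) (ℕtoℚ (b j)) ⟩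
    (ℕtoℚ (a j) - ℕtoℚ (fire G a i j)) + (ℕtoℚ (fire G a i j) - ℕtoℚ (b j))
      ≡⟨ cong₂ _+_ first-firing (game-equation game j) ⟩
    L j i + (L · firings vs) j
      ≡⟨ ≡.sym (L-firings-∷ i vs j) ⟩
    (L · firings (i ∷ vs)) j
      ∎
    where
    open ≡-Reasoning
    first-firing : ℕtoℚ (a j) - ℕtoℚ (fire G a i j) ≡ L j i
    first-firing = trans (cong (λ t → ℕtoℚ (a j) - t) (fire-effect a i canFire j))
                         (solve 2 (λ x l → x :- (x :- l) := l) refl (ℕtoℚ (a j)) (L j i))

  -- The number of chips is preserved, since the columns of L sum to zero.
  chips-preserved : ∀ {a vs b} → Game G a vs b → ∑ℚ ⟦ a ⟧ ≡ ∑ℚ ⟦ b ⟧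
  chips-preserved {a} {vs} {b} game = x∙y⁻¹≈ε⇒x≈y (∑ℚ ⟦ a ⟧) (∑ℚ ⟦ b ⟧) (begin
    ∑ℚ ⟦ a ⟧ - ∑ℚ ⟦ b ⟧            ≡⟨ ≡.sym (∑-- ⟦ a ⟧ ⟦ b ⟧) ⟩
    ∑ℚ (λ j → ⟦ a ⟧ j - ⟦ b ⟧ j)   ≡⟨ ∑-cong (game-equation game) ⟩
    ∑ℚ (L · firings vs)            ≡⟨ ∑-· L L-colsum (firings vs) ⟩
    0ℚ                             ∎)
    where open ≡-Reasoning

  twice-chips : ∀ {a vs b} → Game G a vs b → ℕtoℚ (2 ℕ.* chips a) ≡ ∑ℚ ⟦ a ⟧ + ∑ℚ ⟦ b ⟧
  twice-chips {a} {b = b} game = begin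
    ℕtoℚ (2 ℕ.* chips a)             ≡⟨ cong (λ t → ℕtoℚ (chips a ℕ.+ t)) (ℕₚ.+-identityʳ (chips a)) ⟩
    ℕtoℚ (chips a ℕ.+ chips a)       ≡⟨ ℕtoℚ-+ (chips a) (chips a) ⟩
    ℕtoℚ (chips a) + ℕtoℚ (chips a)  ≡⟨ cong₂ _+_ (ℕtoℚ-∑ a) (trans (ℕtoℚ-∑ a) (chips-preserved game)) ⟩
    ∑ℚ ⟦ a ⟧ + ∑ℚ ⟦ b ⟧              ∎
    where open ≡-Reasoning

  others-gain : ∀ a i k → ¬ k ≡ i → a k ℕ.≤ fire G a i k
  others-gain a i k k≢i with k ≟ i
  ... | yes k≡i = ⊥-elim (k≢i k≡i)
  ... | no _ with adj G i k
  ...   | true  = ℕₚ.n≤1+n (a k)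
  ...   | false = ℕₚ.≤-refl

  idle-vertex-gains : ∀ {a vs b} → Game G a vs b → ∀ k → count k vs ≡ 0 → a k ℕ.≤ b k
  idle-vertex-gains done k _ = ℕₚ.≤-refl
  idle-vertex-gains (fires {a} {i} _ game) k idle with k ≟ i
  ... | yes _  = ⊥-elim (ℕₚ.1+n≢0 idle)
  ... | no k≢i = ℕₚ.≤-trans (others-gain a i k k≢i) (idle-vertex-gains game k idle)

  stable-margin : ∀ {b} → Stable G b → ∀ k → 1ℚ + ℕtoℚ (b k) ≤ ℕtoℚ (maxDegree G)
  stable-margin {b} stable k = ≤-trans (≤-reflexive (≡.sym (ℕtoℚ-+ 1 (b k))))
                                 (ℕtoℚ-mono (ℕₚ.≤-trans (stable k) (maxℕ-ub (degree G) k)))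

-- With y = a - b = L x and u = X y we have L u = L X L x = y, so
-- x - u lies in the kernel of L and is constant, while ∑ u = 0.  Evaluating the constant
-- at a vertex k that never fires gives  s = n ∑ⱼ Xₖⱼ (bⱼ - aⱼ).
module _ {n} {G : SimpleGraph n} (connected : Connected G)
         {X : Matrix n} (pinv : IsPseudoInverse (laplacian G) X)
         {a b : Config n} {vs : List (Fin n)} (game : Game G a vs b) where

  open Laplacian G
  open ChipFiring G
  open PseudoInverse L-sym pinv

  private
    x y u z : Vector n
    x = firings vs
    y j = ⟦ a ⟧ j - ⟦ b ⟧ j
    u = X · y
    z = x +[ - 1ℚ ] u

    Lx≡y : ∀ p → (L · x) p ≡ y p
    Lx≡y p = ≡.sym (game-equation game p)

    Lu≡y : ∀ p → (L · u) p ≡ y p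
    Lu≡y p = begin
      (L · X · y) p           ≡⟨ ·-assoc L X y p ⟩
      ((L ⊗ X) · y) p         ≡⟨ ∑-cong (λ j → cong ((L ⊗ X) p j *_) (≡.sym (Lx≡y j))) ⟩
      ((L ⊗ X) · L · x) p     ≡⟨ ·-assoc (L ⊗ X) L x p ⟩
      (((L ⊗ X) ⊗ L) · x) p   ≡⟨ ∑-cong (λ q → cong (_* x q) (LXL≈L p q)) ⟩
      (L · x) p               ≡⟨ Lx≡y p ⟩
      y p                     ∎
      where open ≡-Reasoning

    z-constant : ∀ i j → z i ≡ z j
    z-constant = L-kernel connected z (λ p → begin
      (L · z) p                      ≡⟨ ·-linear L x (- 1ℚ) u p ⟩
      (L · x) p + - 1ℚ * (L · u) p   ≡⟨ cong₂ (λ s t → s + - 1ℚ * t) (Lx≡y p) (Lu≡y p) ⟩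
      y p + - 1ℚ * y p               ≡⟨ solve 1 (λ t → t :+ con (- 1ℚ) :* t := con 0ℚ) refl (y p) ⟩
      0ℚ                             ∎)
      where open ≡-Reasoning

    ∑u≡0 : ∑ℚ u ≡ 0ℚ
    ∑u≡0 = begin
      ∑ℚ (X · y)         ≡⟨ ∑-cong (λ i → ∑-cong (λ j → cong (X i j *_) (≡.sym (Lx≡y j)))) ⟩
      ∑ℚ (X · L · x)     ≡⟨ ∑-cong (·-assoc X L x) ⟩
      ∑ℚ ((X ⊗ L) · x)   ≡⟨ ∑-· (X ⊗ L) (XL-colsum L-constant) x ⟩
      0ℚ                 ∎
      where open ≡-Reasoning

  firing-identity : ∀ k → count k vs ≡ 0 →
                    ℕtoℚ (length vs) ≡ ℕtoℚ n * ∑ℚ (λ j → X k j * (⟦ b ⟧ j - ⟦ a ⟧ j))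
  firing-identity k idle = begin
    ℕtoℚ (length vs)                 ≡⟨ ≡.sym (firings-total vs) ⟩
    ∑ℚ x                             ≡⟨ solve 1 (λ s → s := s :+ con (- 1ℚ) :* con 0ℚ) refl (∑ℚ x) ⟩
    ∑ℚ x + - 1ℚ * 0ℚ                 ≡⟨ cong (λ t → ∑ℚ x + - 1ℚ * t) (≡.sym ∑u≡0) ⟩
    ∑ℚ x + - 1ℚ * ∑ℚ u               ≡⟨ cong (∑ℚ x +_) (≡.sym (∑-*ˡ (- 1ℚ) u)) ⟩
    ∑ℚ x + ∑ℚ (λ i → - 1ℚ * u i)     ≡⟨ ≡.sym (∑-+ x (λ i → - 1ℚ * u i)) ⟩
    ∑ℚ z                             ≡⟨ ∑-cong (λ i → z-constant i k) ⟩
    ∑ℚ {n} (λ _ → z k)               ≡⟨ ∑-const {n} (z k) ⟩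
    ℕtoℚ n * (x k + - 1ℚ * u k)      ≡⟨ cong (λ t → ℕtoℚ n * (ℕtoℚ t + - 1ℚ * u k)) idle ⟩
    ℕtoℚ n * (0ℚ + - 1ℚ * u k)       ≡⟨ cong (ℕtoℚ n *_) (trans (+-identityˡ (- 1ℚ * u k)) row-k) ⟩
    ℕtoℚ n * ∑ℚ (λ j → X k j * (⟦ b ⟧ j - ⟦ a ⟧ j))
                                     ∎
    where
    open ≡-Reasoning
    row-k : - 1ℚ * u k ≡ ∑ℚ (λ j → X k j * (⟦ b ⟧ j - ⟦ a ⟧ j))
    row-k = trans (≡.sym (∑-*ˡ (- 1ℚ) (λ j → X k j * y j)))
      (∑-cong (λ j → solve 3 (λ c p q → con (- 1ℚ) :* (c :* (p :- q)) := c :* (q :- p))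
                             refl (X k j) (⟦ a ⟧ j) (⟦ b ⟧ j)))

module _ {m} (X : Matrix (suc m)) where

  private
    off : Fin (suc m) → Fin (suc m) → ℚ
    off i j = if does (i ≟ j) then 0ℚ else ∣ X i j ∣

    off≤o : ∀ i j → off i j ≤ maxOffDiag X
    off≤o i j = ≤-trans (maxℚ-ub (off i) j) (maxℚ-ub (λ i → maxℚ (off i)) i)

  diag≤maxDiag : ∀ i → X i i ≤ maxDiag X
  diag≤maxDiag = maxℚ-ub (λ i → X i i)

  offDiag≤maxOffDiag : ∀ i j → ¬ i ≡ j → ∣ X i j ∣ ≤ maxOffDiag X
  offDiag≤maxOffDiag i j i≢j with i ≟ j | off≤o i j
  ... | yes i≡j | _       = ⊥-elim (i≢j i≡j)
  ... | no _    | ∣Xij∣≤o = ∣Xij∣≤o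

  maxOffDiag-nonneg : 0ℚ ≤ maxOffDiag X
  maxOffDiag-nonneg = off≤o zero zero

  maxOffDiag≤maxDiag : (∀ i → 0ℚ ≤ X i i) → (∀ i j → ∣ X i j ∣ + ∣ X i j ∣ ≤ X i i + X j j) →
                       maxOffDiag X ≤ maxDiag X
  maxOffDiag≤maxDiag diag-nonneg offdiag-bound =
    maxℚ-lub (λ i → maxℚ (off i)) (maxDiag X) (λ i → maxℚ-lub (off i) (maxDiag X) (off≤f i))
    where
    off≤f : ∀ i j → off i j ≤ maxDiag X
    off≤f i j with i ≟ j
    ... | yes _ = ≤-trans (diag-nonneg i) (diag≤maxDiag i)
    ... | no _  = double-reflects-≤ (≤-trans (offdiag-bound i j) (+-mono-≤ (diag≤maxDiag i) (diag≤maxDiag j)))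

-- Bounding the k-th term by f (Bₖ - Aₖ) and the others by o (Aⱼ + Bⱼ) gives
--   ∑ⱼ rⱼ (Bⱼ - Aⱼ) ≤ f (Δ - 1) + o (∑A + ∑B - Δ + 1).
weighted-change-bound :
  ∀ {n} (r A B : Vector n) (k : Fin n) {f o Δ : ℚ} →
  (∀ j → 0ℚ ≤ A j) → (∀ j → 0ℚ ≤ B j) →
  r k ≤ f → (∀ j → ¬ j ≡ k → ∣ r j ∣ ≤ o) → 0ℚ ≤ o → o ≤ f →
  A k ≤ B k → 1ℚ + B k ≤ Δ →
  ∑ℚ (λ j → r j * (B j - A j)) ≤ f * (Δ - 1ℚ) + o * (∑ℚ A + ∑ℚ B - Δ + 1ℚ)
weighted-change-bound r A B k {f} {o} {Δ} 0≤A 0≤B rₖ≤f ∣r∣≤o 0≤o o≤f Aₖ≤Bₖ Bₖ<Δ = begin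
  ∑ℚ (λ j → r j * (B j - A j))
    ≤⟨ ∑-mono termwise ⟩
  ∑ℚ (λ j → o * (A j + B j) + correction j)
    ≡⟨ ∑-+ (λ j → o * (A j + B j)) correction ⟩
  ∑ℚ (λ j → o * (A j + B j)) + ∑ℚ correction
    ≡⟨ cong₂ _+_ (trans (∑-*ˡ o (λ j → A j + B j)) (cong (o *_) (∑-+ A B))) (∑-pick k (λ _ → excess)) ⟩
  o * (∑ℚ A + ∑ℚ B) + excess
    ≤⟨ 0≤-⇒≤ (≤-trans slack-nonneg (≤-reflexive (≡.sym slack))) ⟩
  f * (Δ - 1ℚ) + o * (∑ℚ A + ∑ℚ B - Δ + 1ℚ)
    ∎
  where
  open ≤-Reasoning
  α β excess : ℚ
  α = A k
  β = B k
  excess = f * (β - α) - o * (α + β)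

  -- the k-th term exceeds its generic bound o (Aₖ + Bₖ) by at most `excess`
  correction : Vector _
  correction j = if does (j ≟ k) then excess else 0ℚ

  at-k : r k * (β - α) ≤ o * (α + β) + excess
  at-k = ≤-trans (*-monoʳ-≤-nonNeg (β - α) {{nonNegative (≤⇒0≤- Aₖ≤Bₖ)}} rₖ≤f) (≤-reflexive
    (solve 4 (λ f o α β → f :* (β :- α) := o :* (α :+ β) :+ (f :* (β :- α) :- o :* (α :+ β))) refl f o α β))

  off-k : ∀ j → ¬ j ≡ k → r j * (B j - A j) ≤ o * (A j + B j) + 0ℚ
  off-k j j≢k = begin
    r j * (B j - A j)          ≤⟨ p≤∣p∣ (r j * (B j - A j)) ⟩
    ∣ r j * (B j - A j) ∣      ≡⟨ ∣p*q∣≡∣p∣*∣q∣ (r j) (B j - A j) ⟩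
    ∣ r j ∣ * ∣ B j - A j ∣    ≤⟨ *-monoʳ-≤-nonNeg ∣ B j - A j ∣ {{∣-∣-nonNeg (B j - A j)}} (∣r∣≤o j j≢k) ⟩
    o * ∣ B j - A j ∣          ≤⟨ *-monoʳ-nonneg 0≤o (∣p-q∣≤∣p∣+∣q∣ (B j) (A j)) ⟩
    o * (∣ B j ∣ + ∣ A j ∣)    ≡⟨ cong₂ (λ s t → o * (s + t)) (0≤p⇒∣p∣≡p (0≤B j)) (0≤p⇒∣p∣≡p (0≤A j)) ⟩
    o * (B j + A j)            ≡⟨ solve 3 (λ o b a → o :* (b :+ a) := o :* (a :+ b) :+ con 0ℚ) refl o (B j) (A j) ⟩
    o * (A j + B j) + 0ℚ       ∎

  termwise : ∀ j → r j * (B j - A j) ≤ o * (A j + B j) + (if does (j ≟ k) then excess else 0ℚ)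
  termwise j with j ≟ k
  ... | yes refl = at-k
  ... | no j≢k   = off-k j j≢k

  slack : f * (Δ - 1ℚ) + o * (∑ℚ A + ∑ℚ B - Δ + 1ℚ) - (o * (∑ℚ A + ∑ℚ B) + excess)
          ≡ (f - o) * ((Δ - (1ℚ + β)) + α) + (o * α + o * α)
  slack = solve 6 (λ f o Δ S α β →
                     f :* (Δ :- con 1ℚ) :+ o :* (S :- Δ :+ con 1ℚ) :- (o :* S :+ (f :* (β :- α) :- o :* (α :+ β)))
                       := (f :- o) :* ((Δ :- (con 1ℚ :+ β)) :+ α) :+ (o :* α :+ o :* α))
                  refl f o Δ (∑ℚ A + ∑ℚ B) α β

  slack-nonneg : 0ℚ ≤ (f - o) * ((Δ - (1ℚ + β)) + α) + (o * α + o * α)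
  slack-nonneg = +-mono-≤ (*-nonneg (≤⇒0≤- o≤f) (+-mono-≤ (≤⇒0≤- Bₖ<Δ) (0≤A k)))
                          (+-mono-≤ (*-nonneg 0≤o (0≤A k)) (*-nonneg 0≤o (0≤A k)))

mainTheorem2 : (n : ℕ) (G : SimpleGraph n) → Connected G →
    (X : Matrix n) → IsPseudoInverse (laplacian G) X →
    (a b : Config n) (vs : List (Fin n)) → Game G a vs b → Stable G b →
    (k : Fin n) → count k vs ≡ 0 →
    ℕtoℚ (length vs) ≤
      ℕtoℚ n * (maxDiag X * (ℕtoℚ (maxDegree G) - ℕtoℚ 1)
                + maxOffDiag X * (ℕtoℚ (2 Data.Nat.* chips a) - ℕtoℚ (maxDegree G) + ℕtoℚ 1))
mainTheorem2 zero    _ _ _ _ _ _ _ _ _ () _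
mainTheorem2 (suc m) G connected X pinv a b vs game stable k idle = begin
  ℕtoℚ (length vs)
    ≡⟨ firing-identity connected pinv game k idle ⟩
  ℕtoℚ (suc m) * ∑ℚ (λ j → X k j * (⟦ b ⟧ j - ⟦ a ⟧ j))
    ≤⟨ *-monoʳ-nonneg (ℕtoℚ-nonneg (suc m)) estimate ⟩
  ℕtoℚ (suc m) * (f * (Δ - 1ℚ) + o * (∑ℚ ⟦ a ⟧ + ∑ℚ ⟦ b ⟧ - Δ + 1ℚ))
    ≡⟨ cong (λ t → ℕtoℚ (suc m) * (f * (Δ - 1ℚ) + o * (t - Δ + 1ℚ))) (≡.sym (twice-chips game)) ⟩
  ℕtoℚ (suc m) * (f * (Δ - 1ℚ) + o * (ℕtoℚ (2 ℕ.* chips a) - Δ + 1ℚ))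
    ∎
  where
  open ≤-Reasoning
  open Laplacian G
  open ChipFiring G
  open PseudoInverse L-sym pinv
  f o Δ : ℚ
  f = maxDiag X
  o = maxOffDiag X
  Δ = ℕtoℚ (maxDegree G)

  estimate : ∑ℚ (λ j → X k j * (⟦ b ⟧ j - ⟦ a ⟧ j))
               ≤ f * (Δ - 1ℚ) + o * (∑ℚ ⟦ a ⟧ + ∑ℚ ⟦ b ⟧ - Δ + 1ℚ)
  estimate = weighted-change-bound (X k) ⟦ a ⟧ ⟦ b ⟧ k
    (λ j → ℕtoℚ-nonneg (a j)) (λ j → ℕtoℚ-nonneg (b j))
    (diag≤maxDiag X k) (λ j j≢k → offDiag≤maxOffDiag X k j (λ k≡j → j≢k (≡.sym k≡j)))
    (maxOffDiag-nonneg X) (maxOffDiag≤maxDiag X (X-diag-nonneg L-psd) (X-offdiag-bound L-psd))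
    (ℕtoℚ-mono (idle-vertex-gains game k idle)) (stable-margin stable k)
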